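{- Let $A$ be a finite set, $k \ge 1$, and let $S$ be a presheaf on $S_k(A)$ (a functor $S_k(A)^{op} \to \mathbf{Set}$). If $S(C) = \emptyset$ for some $C \in S_k(A) \setminus \{\emptyset\}$, then $S^{\Diamond}$ is the empty presheaf, i.e. $S^{\Diamond}(C') = \emptyset$ for all $C' \in S_k(A)$.
   Context: $S_k(A)$ is the poset, ordered by inclusion, of subsets of $A$ of cardinality at most $k$. A presheaf is flasque if all restriction maps are surjective. A subpresheaf $T$ of $S$ has $T(C) \subseteq S(C)$ for all $C$, closed under the restriction maps of $S$. $S^{\Diamond}$ denotes the largest flasque subpresheaf of $S$ (the pointwise union of all flasque subpresheaves of $S$). -}

module Defs where

open import Level using (Level; suc; _⊔_) renaming (zero to 0ℓ)
open import Data.Nat using (ℕ; _≤_)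
open import Data.Fin.Subset using (Subset; _⊆_; ∣_∣)
open import Data.Product using (Σ; ∃; _×_; _,_; proj₁)
open import Relation.Binary.PropositionalEquality using (_≡_)

-- The finite set A is modelled as Fin n.
-- Objects of the poset S_k(A): subsets of Fin n of cardinality at most k.
Obj : ℕ → ℕ → Set
Obj n k = Σ (Subset n) (λ C → ∣ C ∣ ≤ k)

_≼_ : ∀ {n k} → Obj n k → Obj n k → Set
C ≼ D = proj₁ C ⊆ proj₁ D

-- A presheaf on S_k(A), i.e. a functor S_k(A)^op → Set.
-- Since S_k(A) is a poset (at most one arrow between objects), the
-- functor laws are required for arbitrary inclusion proofs.
record Presheaf (n k : ℕ) : Set₁ where
  field
    F    : Obj n k → Set
    res  : ∀ C D → C ≼ D → F D → F C
    res-id   : ∀ C (p : C ≼ C) (x : F C) → res C C p x ≡ x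
    res-comp : ∀ C D E (p : C ≼ D) (q : D ≼ E) (r : C ≼ E) (x : F E) →
               res C D p (res D E q x) ≡ res C E r x
open Presheaf public

record Subpresheaf {n k : ℕ} (S : Presheaf n k) : Set₁ where
  field
    mem    : ∀ C → F S C → Set
    closed : ∀ C D (p : C ≼ D) (x : F S D) → mem D x → mem C (res S C D p x)
open Subpresheaf public

Flasque : ∀ {n k} {S : Presheaf n k} → Subpresheaf S → Set
Flasque {S = S} T =
  ∀ C D (p : C ≼ D) (y : F S C) → mem T C y →
  ∃ λ (x : F S D) → mem T D x × res S C D p x ≡ y

Diamond : ∀ {n k} (S : Presheaf n k) → ∀ C → F S C → Set₁
Diamond S C x = ∃ λ (T : Subpresheaf S) → Flasque T × mem T C x

module Submission where

open import Defs
open import Data.Nat using (ℕ; _≤_; z≤n)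
open import Data.Fin.Subset using (Nonempty; ⊥)
open import Data.Fin.Subset.Properties using (∣⊥∣≡0; ⊆-min)
open import Data.Product using (∃; _×_; proj₁; _,_)
open import Relation.Nullary using (¬_)
open import Relation.Binary.PropositionalEquality using (subst; sym)

-- Every object lies above the empty set ∅ ∈ S_k(A). Restricting a section of a
-- flasque T down to ∅ and lifting it back up therefore reaches every object, so a
-- nonempty flasque subpresheaf is nonempty everywhere. An empty S(C) thus kills
-- every flasque subpresheaf, and with it S^◇.

∅-obj : ∀ {n k} → Obj n k
∅-obj {n} {k} = ⊥ , subst (_≤ k) (sym (∣⊥∣≡0 n)) z≤n

∅-obj-≼ : ∀ {n k} (C : Obj n k) → ∅-obj ≼ C
∅-obj-≼ _ = ⊆-min _

flasque-inhabited : ∀ {n k} {S : Presheaf n k} {T : Subpresheaf S} → Flasque T →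
  ∀ C (x : F S C) → mem T C x → ∀ D → ∃ λ (y : F S D) → mem T D y
flasque-inhabited {S = S} {T} flasque C x x∈T D
  with flasque ∅-obj D (∅-obj-≼ D) (res S ∅-obj C (∅-obj-≼ C) x)
                 (closed T ∅-obj C (∅-obj-≼ C) x x∈T)
... | y , y∈T , _ = y , y∈T

Diamond-inhabited : ∀ {n k} (S : Presheaf n k) C (x : F S C) → Diamond S C x →
  ∀ D → F S D
Diamond-inhabited S C x (T , flasque , x∈T) D =
  proj₁ (flasque-inhabited {T = T} flasque C x x∈T D)

proposition4p2 : (n k : ℕ) → 1 ≤ k → (S : Presheaf n k) →
    (∃ λ (C : Obj n k) → Nonempty (proj₁ C) × ¬ F S C) →
    ∀ (C′ : Obj n k) (x : F S C′) → ¬ Diamond S C′ x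
proposition4p2 n k _ S (C , _ , S[C]-empty) C′ x x∈S◇ =
  S[C]-empty (Diamond-inhabited S C′ x x∈S◇ C)
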